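{- Let $n=p_1^{n_1}p_2^{n_2}\cdots p_r^{n_r}$, where $r\geq 2$, $n_1,\ldots,n_r$ are positive integers and $p_1,\ldots,p_r$ are distinct primes with $p_1<p_2<\cdots<p_r$. Then $\kappa(\mathcal{P}(C_n))=\phi(n)+1$ if and only if $r=2$ and $n=p_1p_2$.
   Context: $C_n$ is the cyclic group of order $n$ and $\phi$ is Euler's totient function. The power graph $\mathcal{P}(C_n)$ is the simple undirected graph with vertex set $C_n$ in which two distinct vertices are adjacent if and only if one of them is a power of the other. $\kappa(\mathcal{P}(C_n))$ denotes its vertex connectivity: the minimum number of vertices whose removal leaves an induced subgraph that is disconnected or has only one vertex. -}

module Defs where

open import Data.Nat using (ℕ; zero; suc; _+_; _*_; _^_; _≤_; _≟_)
open import Data.Nat.GCD using (gcd)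
open import Data.Fin using (Fin; toℕ)
open import Data.Fin.Subset using (Subset; _∈_; _∉_; ∣_∣; ∁)
open import Data.List using (List; length; filter; upTo; tabulate)
open import Data.Nat.ListAction using (product)
open import Data.Product using (Σ; ∃; _×_)
open import Data.Sum using (_⊎_)
open import Relation.Nullary using (¬_)
open import Relation.Binary.PropositionalEquality using (_≡_)
open import Relation.Binary.Construct.Closure.ReflexiveTransitive using (Star)

-- Euler's totient: number of k with 0 ≤ k < n and gcd k n = 1
-- (gives φ 1 = 1, φ n = #{1 ≤ k ≤ n : gcd k n = 1} for n ≥ 1).
φ : ℕ → ℕ
φ n = length (filter (λ k → gcd k n ≟ 1) (upTo n))

-- The cyclic group C_n is modelled as (ℤ/nℤ, +) with carrier Fin n.
-- y is a power of x  iff  y = k·x in ℤ/nℤ for some k ∈ ℕ,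
-- i.e. k * x = q * n + y for some k, q (y < n).
IsPowerOf : {n : ℕ} → Fin n → Fin n → Set
IsPowerOf {n} y x = Σ ℕ λ k → Σ ℕ λ q → k * toℕ x ≡ q * n + toℕ y

PAdj : {n : ℕ} → Fin n → Fin n → Set
PAdj x y = ¬ (x ≡ y) × (IsPowerOf y x ⊎ IsPowerOf x y)

AdjOutside : {n : ℕ} → Subset n → Fin n → Fin n → Set
AdjOutside S x y = x ∉ S × y ∉ S × PAdj x y

DisconnectedAfterRemoving : {n : ℕ} → Subset n → Set
DisconnectedAfterRemoving S =
  ∃ λ u → ∃ λ v → u ∉ S × v ∉ S × ¬ Star (AdjOutside S) u v

IsCut : {n : ℕ} → Subset n → Set
IsCut S = DisconnectedAfterRemoving S ⊎ ∣ ∁ S ∣ ≡ 1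

ConnectivityIs : ℕ → ℕ → Set
ConnectivityIs n m =
  (Σ (Subset n) λ S → IsCut S × ∣ S ∣ ≡ m) × ((S : Subset n) → IsCut S → m ≤ ∣ S ∣)

primeProduct : {r : ℕ} → (Fin r → ℕ) → (Fin r → ℕ) → ℕ
primeProduct p e = product (tabulate (λ i → p i ^ e i))

module Submission where

-- Call a vertex dominating if it is 0 or a generator of C_n: it is adjacent to every other
-- vertex, so every disconnecting set contains the φ(n) + 1 dominating vertices, while leaving a
-- single vertex costs more since the two vertices p₁, p₂ are not dominating. Hence
-- κ = φ(n) + 1 exactly when removing the dominating vertices disconnects the graph. A
-- non-dominating x has a prime r ∣ gcd(x, n) and the path x — r — r p₁ — p₁, unless r p₁ = n,
-- which forces n = p₁ p₂. For n = p₁ p₂ conversely, divisibility by p₁ is invariant along edges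
-- between non-dominating vertices, separating p₁ from p₂.

open import Data.Bool using (true)
open import Data.Empty using (⊥; ⊥-elim)
open import Data.Fin using (Fin; zero; suc; toℕ; fromℕ<) renaming (_<_ to _<ᶠ_; _≟_ to _≟ᶠ_)
open import Data.Fin.Properties using (toℕ<n; toℕ-fromℕ<)
open import Data.Fin.Subset using (Subset; _∈_; _∉_; ∣_∣; ∁; _⊆_; _∪_; ⁅_⁆)
open import Data.Fin.Subset.Properties
  using ( _∈?_; ⊆-antisym; p⊆q⇒∣p∣≤∣q∣; p⊂q⇒∣p∣<∣q∣; ∣∁p∣≡n∸∣p∣; ∣p∣≤n
        ; p⊆p∪q; x∈p∪q⁺; x∈p∪q⁻; x∈⁅x⁆; x∈⁅y⁆⇒x≡y)
open import Data.List using ([]; _∷_; length; filter; applyUpTo; tabulate)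
open import Data.List.Relation.Unary.All using (_∷_)
open import Data.List.Relation.Unary.All.Properties using (tabulate⁺)
open import Data.Nat
  using ( ℕ; zero; suc; _+_; _*_; _^_; _∸_; _<_; _≤_; s≤s; z<s
        ; NonZero; ≢-nonZero; >-nonZero; nonTrivial⇒n>1)
open import Data.Nat.Divisibility
  using ( _∣_; divides; ∣-refl; ∣-trans; ∣1⇒≡1; ∣⇒≤; ∣m+n∣m⇒∣n
        ; ∣n⇒∣m*n; m∣m*n; n∣m*n; *-pres-∣; *-monoʳ-∣)
open import Data.Nat.GCD using (gcd; gcd-greatest; gcd[m,n]∣m; gcd[m,n]∣n; gcd[m,n]≢0; module Bézout)
open import Data.Nat.Coprimality using (gcd≡1⇒coprime; coprime-Bézout)
open import Data.Nat.ListAction using (product)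
open import Data.Nat.ListAction.Properties using (product≢0)
open import Data.Nat.Primality
  using (Prime; euclidsLemma; prime⇒irreducible; prime⇒nonZero; prime⇒nonTrivial; ¬prime[1])
open import Data.Nat.Primality.Factorisation using (factorise)
open import Data.Nat.Properties
open import Data.Nat.Tactic.RingSolver using (solve-∀)
open import Data.Product using (∃-syntax; ∃₂; _×_; _,_; proj₂)
open import Data.Sum using (_⊎_; inj₁; inj₂; [_,_]′)
import Data.Sum as Sum
import Data.Vec as Vec
open import Data.Vec.Properties using (lookup∘tabulate; []=⇒lookup; lookup⇒[]=)
open import Defs
open import Function using (_∘_; id)
open import Function.Bundles using (_⇔_; mk⇔)
import Function.Properties.Equivalence as ⇔
open import Level using (Level)
open import Relation.Binary.Definitions using (Symmetric)
open import Relation.Binary.Construct.Closure.ReflexiveTransitive using (Star; ε; _◅_; _◅◅_; reverse)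
open import Relation.Binary.PropositionalEquality
open import Relation.Nullary using (yes; no; does; contradiction)
open import Relation.Nullary.Decidable using (dec-true; dec-false; decidable-stable; _⊎-dec_)
open import Relation.Unary using (Pred; Decidable)

private variable
  ℓ : Level
  a d e m n p q : ℕ

prime>1 : Prime p → 1 < p
prime>1 {p} p-prime = nonTrivial⇒n>1 p {{prime⇒nonTrivial p-prime}}

prime∣prime⇒≡ : Prime p → Prime q → p ∣ q → p ≡ q
prime∣prime⇒≡ p-prime q-prime p∣q with prime⇒irreducible q-prime p∣q
... | inj₁ refl = contradiction p-prime ¬prime[1]
... | inj₂ p≡q = p≡q

∃prime∣ : 1 < m → ∃[ r ] Prime r × r ∣ m
∃prime∣ {m} 1<m with factorise m {{>-nonZero (<-trans z<s 1<m)}}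
... | record { factors = [] ; isFactorisation = m≡1 } = contradiction m≡1 (>⇒≢ 1<m)
... | record { factors = r ∷ rs ; isFactorisation = m≡r*rs ; factorsPrime = r-prime ∷ _ } =
  r , r-prime , subst (r ∣_) (sym m≡r*rs) (m∣m*n (product rs))

distinctPrimes∣⇒*∣ : Prime p → Prime q → p ≢ q → p ∣ n → q ∣ n → p * q ∣ n
distinctPrimes∣⇒*∣ {q = q} p-prime q-prime p≢q p∣n (divides t refl) with euclidsLemma t q p-prime p∣n
... | inj₁ p∣t = *-pres-∣ p∣t ∣-refl
... | inj₂ p∣q = contradiction (prime∣prime⇒≡ p-prime q-prime p∣q) p≢q

module _ {P : Pred ℕ ℓ} (P? : Decidable P) where

  select : (n : ℕ) → Subset n
  select n = Vec.tabulate (λ i → does (P? (toℕ i)))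

  ∈-select⁺ : {i : Fin n} → P (toℕ i) → i ∈ select n
  ∈-select⁺ {i = i} Pi = lookup⇒[]= i _ (trans (lookup∘tabulate _ i) (dec-true (P? (toℕ i)) Pi))

  ∈-select⁻ : {i : Fin n} → i ∈ select n → P (toℕ i)
  ∈-select⁻ {i = i} i∈ = decidable-stable (P? (toℕ i)) λ ¬Pi →
    contradiction (trans (sym selected) (dec-false (P? (toℕ i)) ¬Pi)) λ ()
    where
    selected : does (P? (toℕ i)) ≡ true
    selected = trans (sym (lookup∘tabulate _ i)) ([]=⇒lookup i∈)

  ∣tabulate-does∣≡length-filter : ∀ (g : ℕ → ℕ) m →
    ∣ Vec.tabulate {n = m} (λ i → does (P? (g (toℕ i)))) ∣ ≡ length (filter P? (applyUpTo g m))
  ∣tabulate-does∣≡length-filter g zero = refl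
  ∣tabulate-does∣≡length-filter g (suc m) with P? (g 0)
  ... | yes _ = cong suc (∣tabulate-does∣≡length-filter (g ∘ suc) m)
  ... | no _ = ∣tabulate-does∣≡length-filter (g ∘ suc) m

IsDominating : ℕ → ℕ → Set
IsDominating n a = a ≡ 0 ⊎ gcd a n ≡ 1

isDominating? : ∀ n → Decidable (IsDominating n)
isDominating? n a = (a ≟ 0) ⊎-dec (gcd a n ≟ 1)

Dominating : (n : ℕ) → Subset n
Dominating n = select (isDominating? n) n

-- Dominating (2 + m) computes to inside ∷ (the coprimality selection on 1, …, 1 + m), and φ
-- skips 0 since gcd 0 (2 + m) computes to 2 + m.
∣Dominating∣≡φ+1 : 1 < n → ∣ Dominating n ∣ ≡ φ n + 1
∣Dominating∣≡φ+1 {suc zero} (s≤s ())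
∣Dominating∣≡φ+1 {suc (suc m)} _ =
  trans (cong suc (∣tabulate-does∣≡length-filter (λ a → gcd a (2 + m) ≟ 1) suc (suc m)))
        (+-comm 1 _)

divisor∉Dominating : (m<n : m < n) → 1 < m → m ∣ n → fromℕ< m<n ∉ Dominating n
divisor∉Dominating {m} m<n 1<m m∣n m∈D
  with subst (IsDominating _) (toℕ-fromℕ< m<n) (∈-select⁻ (isDominating? _) m∈D)
... | inj₁ m≡0 = <⇒≢ (<-trans z<s 1<m) (sym m≡0)
... | inj₂ gcd≡1 = <⇒≢ 1<m (sym (∣1⇒≡1 (subst (m ∣_) gcd≡1 (gcd-greatest ∣-refl m∣n))))

∉Dominating⇒∃prime∣ : {x : Fin n} → x ∉ Dominating n → ∃[ r ] Prime r × (r ∣ toℕ x) × (r ∣ n)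
∉Dominating⇒∃prime∣ {n} {x} x∉D =
  let r , r-prime , r∣gcd = ∃prime∣ 1<gcd
  in r , r-prime , ∣-trans r∣gcd (gcd[m,n]∣m (toℕ x) n) , ∣-trans r∣gcd (gcd[m,n]∣n (toℕ x) n)
  where
  gcd≢0 : gcd (toℕ x) n ≢ 0
  gcd≢0 = gcd[m,n]≢0 (toℕ x) n (inj₁ (x∉D ∘ ∈-select⁺ (isDominating? n) ∘ inj₁))
  gcd≢1 : gcd (toℕ x) n ≢ 1
  gcd≢1 = x∉D ∘ ∈-select⁺ (isDominating? n) ∘ inj₂
  1<gcd : 1 < gcd (toℕ x) n
  1<gcd = ≤∧≢⇒< (n≢0⇒n>0 gcd≢0) (gcd≢1 ∘ sym)

∣⇒IsPowerOf : {x y : Fin n} → toℕ x ∣ toℕ y → IsPowerOf y x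
∣⇒IsPowerOf (divides c y≡c*x) = c , 0 , sym y≡c*x

IsPowerOf-preserves-∣ : {x y : Fin n} → d ∣ n → d ∣ toℕ x → IsPowerOf y x → d ∣ toℕ y
IsPowerOf-preserves-∣ {d = d} d∣n d∣x (k , q , k*x≡q*n+y) =
  ∣m+n∣m⇒∣n (subst (d ∣_) k*x≡q*n+y (∣n⇒∣m*n k d∣x)) (∣n⇒∣m*n q d∣n)

-- Bézout may only give x a ≡ -1 (mod n); then (n - 1) x is the inverse.
unit-inverse : ∀ m → gcd a (2 + m) ≡ 1 → ∃₂ λ k q → k * a ≡ q * (2 + m) + 1
unit-inverse {a} m gcd≡1 with coprime-Bézout (gcd≡1⇒coprime gcd≡1)
... | Bézout.+- x y 1+y*n≡x*a = x , y , trans (sym 1+y*n≡x*a) (+-comm 1 _)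
... | Bézout.-+ x (suc y) 1+x*a≡y*n = x * suc m , y + m * suc y , +-cancelʳ-≡ (suc m) _ _ (begin
  x * suc m * a + suc m               ≡⟨ factor x a m ⟩
  suc m * (1 + x * a)                 ≡⟨ cong (suc m *_) 1+x*a≡y*n ⟩
  suc m * (suc y * (2 + m))           ≡⟨ unfactor y m ⟩
  (y + m * suc y) * (2 + m) + 1 + suc m ∎)
  where
  open ≡-Reasoning
  factor : ∀ x a m → x * suc m * a + suc m ≡ suc m * (1 + x * a)
  factor = solve-∀
  unfactor : ∀ y m → suc m * (suc y * (2 + m)) ≡ (y + m * suc y) * (2 + m) + 1 + suc m
  unfactor = solve-∀

generator⇒IsPowerOf : ∀ m {x y : Fin (2 + m)} → gcd (toℕ x) (2 + m) ≡ 1 → IsPowerOf y x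
generator⇒IsPowerOf m {x} {y} gcd≡1 with unit-inverse m gcd≡1
... | k , q , k*x≡q*n+1 = toℕ y * k , toℕ y * q , (begin
  toℕ y * k * toℕ x             ≡⟨ *-assoc (toℕ y) k (toℕ x) ⟩
  toℕ y * (k * toℕ x)           ≡⟨ cong (toℕ y *_) k*x≡q*n+1 ⟩
  toℕ y * (q * (2 + m) + 1)     ≡⟨ scale (toℕ y) q m ⟩
  toℕ y * q * (2 + m) + toℕ y   ∎)
  where
  open ≡-Reasoning
  scale : ∀ t q m → t * (q * (2 + m) + 1) ≡ t * q * (2 + m) + t
  scale = solve-∀

Dominating⇒comparable : 1 < n → {d x : Fin n} → d ∈ Dominating n → IsPowerOf d x ⊎ IsPowerOf x d
Dominating⇒comparable {suc zero} (s≤s ())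
Dominating⇒comparable {suc (suc m)} _ d∈D with ∈-select⁻ (isDominating? _) d∈D
... | inj₁ d≡0 = inj₁ (0 , 0 , sym d≡0)
... | inj₂ gcd≡1 = inj₂ (generator⇒IsPowerOf m gcd≡1)

module _ {n : ℕ} (S : Subset n) where

  AdjOutside-sym : Symmetric (AdjOutside S)
  AdjOutside-sym (x∉S , y∉S , x≢y , comparable) = y∉S , x∉S , x≢y ∘ sym , Sum.swap comparable

  comparable⇒Star : {x y : Fin n} → x ∉ S → y ∉ S → IsPowerOf y x ⊎ IsPowerOf x y →
                    Star (AdjOutside S) x y
  comparable⇒Star {x} {y} x∉S y∉S comparable with x ≟ᶠ y
  ... | yes refl = ε
  ... | no x≢y = (x∉S , y∉S , x≢y , comparable) ◅ ε

  Dominating⊆disconnecting : 1 < n → DisconnectedAfterRemoving S → Dominating n ⊆ S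
  Dominating⊆disconnecting 1<n (u , v , u∉S , v∉S , ¬u⇝v) {d} d∈D with d ∈? S
  ... | yes d∈S = d∈S
  ... | no d∉S =
    ⊥-elim (¬u⇝v (comparable⇒Star u∉S d∉S d≷ ◅◅ comparable⇒Star d∉S v∉S (Sum.swap d≷)))
    where
    d≷ : ∀ {x} → IsPowerOf d x ⊎ IsPowerOf x d
    d≷ = Dominating⇒comparable 1<n d∈D

⊆∧∣q∣≤∣p∣⇒q⊆p : {p q : Subset n} → p ⊆ q → ∣ q ∣ ≤ ∣ p ∣ → q ⊆ p
⊆∧∣q∣≤∣p∣⇒q⊆p {p = p} p⊆q ∣q∣≤∣p∣ {x} x∈q with x ∈? p
... | yes x∈p = x∈p
... | no x∉p = contradiction (p⊂q⇒∣p∣<∣q∣ (p⊆q , x , x∈q , x∉p)) (≤⇒≯ ∣q∣≤∣p∣)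

∉⇒∣p∣<∣p∪⁅x⁆∣ : {p : Subset n} {x : Fin n} → x ∉ p → ∣ p ∣ < ∣ p ∪ ⁅ x ⁆ ∣
∉⇒∣p∣<∣p∪⁅x⁆∣ {x = x} x∉p = p⊂q⇒∣p∣<∣q∣ (p⊆p∪q _ , x , x∈p∪q⁺ (inj₂ (x∈⁅x⁆ x)) , x∉p)

two∉⇒2+∣p∣≤n : {p : Subset n} {x y : Fin n} → x ∉ p → y ∉ p → x ≢ y → 2 + ∣ p ∣ ≤ n
two∉⇒2+∣p∣≤n {p = p} {x} {y} x∉p y∉p x≢y = begin
  2 + ∣ p ∣                 ≤⟨ s≤s (∉⇒∣p∣<∣p∪⁅x⁆∣ x∉p) ⟩
  suc ∣ p ∪ ⁅ x ⁆ ∣         ≤⟨ ∉⇒∣p∣<∣p∪⁅x⁆∣ y∉p∪⁅x⁆ ⟩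
  ∣ (p ∪ ⁅ x ⁆) ∪ ⁅ y ⁆ ∣   ≤⟨ ∣p∣≤n ((p ∪ ⁅ x ⁆) ∪ ⁅ y ⁆) ⟩
  _                         ∎
  where
  open ≤-Reasoning
  y∉p∪⁅x⁆ : y ∉ p ∪ ⁅ x ⁆
  y∉p∪⁅x⁆ y∈ = [ y∉p , x≢y ∘ sym ∘ x∈⁅y⁆⇒x≡y x ]′ (x∈p∪q⁻ p ⁅ x ⁆ y∈)

∣∁p∣≡1⇒1+∣p∣≡n : (p : Subset n) → ∣ ∁ p ∣ ≡ 1 → suc ∣ p ∣ ≡ n
∣∁p∣≡1⇒1+∣p∣≡n {n} p ∣∁p∣≡1 = begin
  1 + ∣ p ∣           ≡⟨ cong (_+ ∣ p ∣) (trans (sym ∣∁p∣≡1) (∣∁p∣≡n∸∣p∣ p)) ⟩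
  n ∸ ∣ p ∣ + ∣ p ∣   ≡⟨ m∸n+n≡m (∣p∣≤n p) ⟩
  n                   ∎
  where open ≡-Reasoning

connectivity≡φ+1⇔Dominating-disconnects :
  1 < n → {a b : Fin n} → a ∉ Dominating n → b ∉ Dominating n → a ≢ b →
  ConnectivityIs n (φ n + 1) ⇔ DisconnectedAfterRemoving (Dominating n)
connectivity≡φ+1⇔Dominating-disconnects {n} 1<n a∉D b∉D a≢b = mk⇔ to from
  where
  D : Subset n
  D = Dominating n

  ∣D∣≡φ+1 : ∣ D ∣ ≡ φ n + 1
  ∣D∣≡φ+1 = ∣Dominating∣≡φ+1 1<n

  ∣D∣<∣S∣ : (S : Subset n) → ∣ ∁ S ∣ ≡ 1 → ∣ D ∣ < ∣ S ∣
  ∣D∣<∣S∣ S ∣∁S∣≡1 =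
    ≤-pred (subst (2 + ∣ D ∣ ≤_) (sym (∣∁p∣≡1⇒1+∣p∣≡n S ∣∁S∣≡1))
                  (two∉⇒2+∣p∣≤n a∉D b∉D a≢b))

  to : ConnectivityIs n (φ n + 1) → DisconnectedAfterRemoving D
  to ((S , inj₁ disconnects , ∣S∣≡φ+1) , _) = subst DisconnectedAfterRemoving (sym D≡S) disconnects
    where
    D⊆S : D ⊆ S
    D⊆S = Dominating⊆disconnecting S 1<n disconnects
    D≡S : D ≡ S
    D≡S = ⊆-antisym D⊆S
            (⊆∧∣q∣≤∣p∣⇒q⊆p D⊆S (≤-reflexive (trans ∣S∣≡φ+1 (sym ∣D∣≡φ+1))))
  to ((S , inj₂ ∣∁S∣≡1 , ∣S∣≡φ+1) , _) =
    contradiction (trans ∣D∣≡φ+1 (sym ∣S∣≡φ+1)) (<⇒≢ (∣D∣<∣S∣ S ∣∁S∣≡1))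

  from : DisconnectedAfterRemoving D → ConnectivityIs n (φ n + 1)
  from disconnects =
    (D , inj₁ disconnects , ∣D∣≡φ+1) ,
    λ S isCut → subst (_≤ ∣ S ∣) ∣D∣≡φ+1 (∣D∣≤∣S∣ S isCut)
    where
    ∣D∣≤∣S∣ : (S : Subset n) → IsCut S → ∣ D ∣ ≤ ∣ S ∣
    ∣D∣≤∣S∣ S (inj₁ S-disconnects) =
      p⊆q⇒∣p∣≤∣q∣ (Dominating⊆disconnecting S 1<n S-disconnects)
    ∣D∣≤∣S∣ S (inj₂ ∣∁S∣≡1) = <⇒≤ (∣D∣<∣S∣ S ∣∁S∣≡1)

module TwoPrimeDivisors {n p q : ℕ} .{{_ : NonZero n}} (p-prime : Prime p) (q-prime : Prime q)
                        (p≢q : p ≢ q) (p*q∣n : p * q ∣ n) where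

  private
    D : Subset n
    D = Dominating n
    Adj : Fin n → Fin n → Set
    Adj = AdjOutside D
    instance
      p≢0 : NonZero p
      p≢0 = prime⇒nonZero p-prime
      q≢0 : NonZero q
      q≢0 = prime⇒nonZero q-prime

  p∣n : p ∣ n
  p∣n = ∣-trans (m∣m*n q) p*q∣n

  q∣n : q ∣ n
  q∣n = ∣-trans (n∣m*n p) p*q∣n

  p*q≤n : p * q ≤ n
  p*q≤n = ∣⇒≤ p*q∣n

  p<n : p < n
  p<n = <-≤-trans (m<m*n p q (prime>1 q-prime)) p*q≤n

  q<n : q < n
  q<n = <-≤-trans (subst (q <_) (*-comm q p) (m<m*n q p (prime>1 p-prime))) p*q≤n

  1<n : 1 < n
  1<n = <-trans (prime>1 p-prime) p<n

  P Q : Fin n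
  P = fromℕ< p<n
  Q = fromℕ< q<n

  toℕ-P : toℕ P ≡ p
  toℕ-P = toℕ-fromℕ< p<n

  toℕ-Q : toℕ Q ≡ q
  toℕ-Q = toℕ-fromℕ< q<n

  P∉D : P ∉ D
  P∉D = divisor∉Dominating p<n (prime>1 p-prime) p∣n

  Q∉D : Q ∉ D
  Q∉D = divisor∉Dominating q<n (prime>1 q-prime) q∣n

  P≢Q : P ≢ Q
  P≢Q P≡Q = p≢q (trans (sym toℕ-P) (trans (cong toℕ P≡Q) toℕ-Q))

  ∣⇒Star : {x y : Fin n} → x ∉ D → y ∉ D → (toℕ x ∣ toℕ y) ⊎ (toℕ y ∣ toℕ x) → Star Adj x y
  ∣⇒Star x∉D y∉D = comparable⇒Star D x∉D y∉D ∘ Sum.map ∣⇒IsPowerOf ∣⇒IsPowerOf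

  Star-via-r*p : ∀ {r} {x : Fin n} → Prime r → x ∉ D → r ∣ toℕ x → r * p ∣ n → r * p < n →
                 Star Adj x P
  Star-via-r*p {r} {x} r-prime x∉D r∣x r*p∣n r*p<n =
    ∣⇒Star x∉D R∉D (inj₂ (subst (_∣ toℕ x) (sym toℕ-R) r∣x)) ◅◅
    ∣⇒Star R∉D RP∉D (inj₁ (subst₂ _∣_ (sym toℕ-R) (sym toℕ-RP) (m∣m*n p))) ◅◅
    ∣⇒Star RP∉D P∉D (inj₂ (subst₂ _∣_ (sym toℕ-P) (sym toℕ-RP) (n∣m*n r)))
    where
    instance
      r≢0 : NonZero r
      r≢0 = prime⇒nonZero r-prime
    r<r*p : r < r * p
    r<r*p = m<m*n r p (prime>1 p-prime)
    r<n : r < n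
    r<n = <-trans r<r*p r*p<n
    R RP : Fin n
    R = fromℕ< r<n
    RP = fromℕ< r*p<n
    toℕ-R : toℕ R ≡ r
    toℕ-R = toℕ-fromℕ< r<n
    toℕ-RP : toℕ RP ≡ r * p
    toℕ-RP = toℕ-fromℕ< r*p<n
    R∉D : R ∉ D
    R∉D = divisor∉Dominating r<n (prime>1 r-prime) (∣-trans (m∣m*n p) r*p∣n)
    RP∉D : RP ∉ D
    RP∉D = divisor∉Dominating r*p<n (<-trans (prime>1 r-prime) r<r*p) r*p∣n

  n≡r*p⇒n≡p*q : ∀ {r} → Prime r → n ≡ r * p → n ≡ p * q
  n≡r*p⇒n≡p*q {r} r-prime n≡r*p with euclidsLemma r p q-prime (subst (q ∣_) n≡r*p q∣n)
  ... | inj₁ q∣r = begin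
    n      ≡⟨ n≡r*p ⟩
    r * p  ≡⟨ cong (_* p) (sym (prime∣prime⇒≡ q-prime r-prime q∣r)) ⟩
    q * p  ≡⟨ *-comm q p ⟩
    p * q  ∎
    where open ≡-Reasoning
  ... | inj₂ q∣p = contradiction (sym (prime∣prime⇒≡ q-prime p-prime q∣p)) p≢q

  ∉D⇒Star-P : {x : Fin n} → x ∉ D → Star Adj x P ⊎ n ≡ p * q
  ∉D⇒Star-P {x} x∉D with ∉Dominating⇒∃prime∣ x∉D
  ... | r , r-prime , r∣x , r∣n with r ≟ p
  ...   | yes refl = inj₁ (∣⇒Star x∉D P∉D (inj₂ (subst (_∣ toℕ x) (sym toℕ-P) r∣x)))
  ...   | no r≢p with r * p <? n | distinctPrimes∣⇒*∣ r-prime p-prime r≢p r∣n p∣n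
  ...     | yes r*p<n | r*p∣n = inj₁ (Star-via-r*p r-prime x∉D r∣x r*p∣n r*p<n)
  ...     | no r*p≮n  | r*p∣n =
    inj₂ (n≡r*p⇒n≡p*q r-prime (≤-antisym (≮⇒≥ r*p≮n) (∣⇒≤ r*p∣n)))

  Dominating-disconnects⇒n≡p*q : DisconnectedAfterRemoving D → n ≡ p * q
  Dominating-disconnects⇒n≡p*q (u , v , u∉D , v∉D , ¬u⇝v) with ∉D⇒Star-P u∉D | ∉D⇒Star-P v∉D
  ... | inj₂ n≡p*q | _          = n≡p*q
  ... | inj₁ _     | inj₂ n≡p*q = n≡p*q
  ... | inj₁ u⇝P   | inj₁ v⇝P   = ⊥-elim (¬u⇝v (u⇝P ◅◅ reverse (AdjOutside-sym D) v⇝P))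

  module _ (n≡p*q : n ≡ p * q) where

    ∉D⇒p∣⊎q∣ : {x : Fin n} → x ∉ D → (p ∣ toℕ x) ⊎ (q ∣ toℕ x)
    ∉D⇒p∣⊎q∣ {x} x∉D with ∉Dominating⇒∃prime∣ x∉D
    ... | r , r-prime , r∣x , r∣n with euclidsLemma p q r-prime (subst (r ∣_) n≡p*q r∣n)
    ...   | inj₁ r∣p = inj₁ (subst (_∣ toℕ x) (prime∣prime⇒≡ r-prime p-prime r∣p) r∣x)
    ...   | inj₂ r∣q = inj₂ (subst (_∣ toℕ x) (prime∣prime⇒≡ r-prime q-prime r∣q) r∣x)

    ∉D⇒¬p∣×q∣ : {x : Fin n} → x ∉ D → p ∣ toℕ x → q ∣ toℕ x → ⊥
    ∉D⇒¬p∣×q∣ {x} x∉D p∣x q∣x =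
      <⇒≱ (toℕ<n x) (subst (_≤ toℕ x) (sym n≡p*q) (∣⇒≤ p*q∣x))
      where
      p*q∣x : p * q ∣ toℕ x
      p*q∣x = distinctPrimes∣⇒*∣ p-prime q-prime p≢q p∣x q∣x
      instance
        x≢0 : NonZero (toℕ x)
        x≢0 = ≢-nonZero (x∉D ∘ ∈-select⁺ (isDominating? n) ∘ inj₁)

    Adj-preserves-p∣ : {x y : Fin n} → Adj x y → p ∣ toℕ x → p ∣ toℕ y
    Adj-preserves-p∣ (_ , _ , _ , inj₁ y-powerOf-x) p∣x = IsPowerOf-preserves-∣ p∣n p∣x y-powerOf-x
    Adj-preserves-p∣ (x∉D , y∉D , _ , inj₂ x-powerOf-y) p∣x with ∉D⇒p∣⊎q∣ y∉D
    ... | inj₁ p∣y = p∣y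
    ... | inj₂ q∣y = ⊥-elim (∉D⇒¬p∣×q∣ x∉D p∣x (IsPowerOf-preserves-∣ q∣n q∣y x-powerOf-y))

    Star-preserves-p∣ : {x y : Fin n} → Star Adj x y → p ∣ toℕ x → p ∣ toℕ y
    Star-preserves-p∣ ε = id
    Star-preserves-p∣ (x—y ◅ y⇝z) = Star-preserves-p∣ y⇝z ∘ Adj-preserves-p∣ x—y

    Dominating-disconnects : DisconnectedAfterRemoving D
    Dominating-disconnects = P , Q , P∉D , Q∉D , λ P⇝Q →
      p≢q (prime∣prime⇒≡ p-prime q-prime (subst (p ∣_) toℕ-Q (Star-preserves-p∣ P⇝Q p∣P)))
      where
      p∣P : p ∣ toℕ P
      p∣P = subst (p ∣_) (sym toℕ-P) ∣-refl

  Dominating-disconnects⇔n≡p*q : DisconnectedAfterRemoving D ⇔ n ≡ p * q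
  Dominating-disconnects⇔n≡p*q = mk⇔ Dominating-disconnects⇒n≡p*q Dominating-disconnects

m∣m^e : 1 ≤ e → m ∣ m ^ e
m∣m^e {suc e} {m} _ = m∣m*n (m ^ e)

product-tabulate-∣ : ∀ {k} {f g : Fin k → ℕ} → (∀ i → f i ∣ g i) →
                     product (tabulate f) ∣ product (tabulate g)
product-tabulate-∣ {zero} f∣g = ∣-refl
product-tabulate-∣ {suc k} f∣g = *-pres-∣ (f∣g zero) (product-tabulate-∣ (f∣g ∘ suc))

bases∣primeProduct : ∀ {k} (p e : Fin k → ℕ) → (∀ i → 1 ≤ e i) → product (tabulate p) ∣ primeProduct p e
bases∣primeProduct p e e≥1 = product-tabulate-∣ (m∣m^e ∘ e≥1)

p₀*p₁∣primeProduct : ∀ {k} (p e : Fin (2 + k) → ℕ) → (∀ i → 1 ≤ e i) →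
                     p zero * p (suc zero) ∣ primeProduct p e
p₀*p₁∣primeProduct p e e≥1 =
  ∣-trans (*-monoʳ-∣ (p zero) (m∣m*n (product (tabulate (λ i → p (suc (suc i)))))))
          (bases∣primeProduct p e e≥1)

primeProduct≢0 : ∀ {k} (p e : Fin k → ℕ) → (∀ i → Prime (p i)) → NonZero (primeProduct p e)
primeProduct≢0 p e p-prime = product≢0 (tabulate⁺ λ i → m^n≢0 (p i) (e i) {{prime⇒nonZero (p-prime i)}})

primeProduct≡p₀*p₁⇒k≡0 : ∀ k (p e : Fin (2 + k) → ℕ) → (∀ i → Prime (p i)) → (∀ i → 1 ≤ e i) →
                         primeProduct p e ≡ p zero * p (suc zero) → k ≡ 0
primeProduct≡p₀*p₁⇒k≡0 zero p e p-prime e≥1 _ = refl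
primeProduct≡p₀*p₁⇒k≡0 (suc k) p e p-prime e≥1 ∏≡p₀*p₁ =
  contradiction p₀*[p₁*p₂]≤p₀*p₁ (<⇒≱ p₀*p₁<p₀*[p₁*p₂])
  where
  p₀ p₁ p₂ : ℕ
  p₀ = p zero
  p₁ = p (suc zero)
  p₂ = p (suc (suc zero))
  instance
    p₀≢0 : NonZero p₀
    p₀≢0 = prime⇒nonZero (p-prime zero)
    p₁≢0 : NonZero p₁
    p₁≢0 = prime⇒nonZero (p-prime (suc zero))
    p₀*p₁≢0 : NonZero (p₀ * p₁)
    p₀*p₁≢0 = m*n≢0 p₀ p₁
  p₀*p₁<p₀*[p₁*p₂] : p₀ * p₁ < p₀ * (p₁ * p₂)
  p₀*p₁<p₀*[p₁*p₂] = *-monoʳ-< p₀ (m<m*n p₁ p₂ (prime>1 (p-prime (suc (suc zero)))))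
  p₀*[p₁*p₂]≤p₀*p₁ : p₀ * (p₁ * p₂) ≤ p₀ * p₁
  p₀*[p₁*p₂]≤p₀*p₁ =
    ∣⇒≤ (subst (p₀ * (p₁ * p₂) ∣_) ∏≡p₀*p₁
               (∣-trans p₀*[p₁*p₂]∣∏ (bases∣primeProduct p e e≥1)))
    where
    p₀*[p₁*p₂]∣∏ : p₀ * (p₁ * p₂) ∣ product (tabulate p)
    p₀*[p₁*p₂]∣∏ =
      *-monoʳ-∣ p₀ (*-monoʳ-∣ p₁ (m∣m*n (product (tabulate (λ i → p (suc (suc (suc i))))))))

lemma2p5 : (k : ℕ) (p e : Fin (2 + k) → ℕ) (n : ℕ) →
    (∀ i → Prime (p i)) →
    (∀ i j → i <ᶠ j → p i < p j) →
    (∀ i → 1 ≤ e i) →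
    n ≡ primeProduct p e →
    ConnectivityIs n (φ n + 1) ⇔ (2 + k ≡ 2 × n ≡ p zero * p (suc zero))
lemma2p5 k p e n p-prime p-increasing e≥1 n≡∏ =
  ⇔.trans (connectivity≡φ+1⇔Dominating-disconnects 1<n P∉D Q∉D P≢Q)
          (⇔.trans Dominating-disconnects⇔n≡p*q n≡p₀*p₁⇔r≡2×n≡p₀*p₁)
  where
  instance
    n≢0 : NonZero n
    n≢0 = subst NonZero (sym n≡∏) (primeProduct≢0 p e p-prime)
  p₀*p₁∣n : p zero * p (suc zero) ∣ n
  p₀*p₁∣n = subst (p zero * p (suc zero) ∣_) (sym n≡∏) (p₀*p₁∣primeProduct p e e≥1)
  open TwoPrimeDivisors (p-prime zero) (p-prime (suc zero))
                        (<⇒≢ (p-increasing zero (suc zero) z<s)) p₀*p₁∣n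
  n≡p₀*p₁⇔r≡2×n≡p₀*p₁ : n ≡ p zero * p (suc zero) ⇔ (2 + k ≡ 2 × n ≡ p zero * p (suc zero))
  n≡p₀*p₁⇔r≡2×n≡p₀*p₁ = mk⇔ (λ n≡p₀*p₁ → cong (2 +_) (k≡0 n≡p₀*p₁) , n≡p₀*p₁) proj₂
    where
    k≡0 : n ≡ p zero * p (suc zero) → k ≡ 0
    k≡0 n≡p₀*p₁ = primeProduct≡p₀*p₁⇒k≡0 k p e p-prime e≥1 (trans (sym n≡∏) n≡p₀*p₁)
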